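{- Let $u_1\cdots u_n$ be the place-based non-inversion table of a permutation $\pi\in S_n$. Then for all $i<j$, $\pi(i)<\pi(j)$ implies $u_i<u_j$. Conversely, for $i<j$, if $u_i<u_{i+1},\ldots,u_j$ (i.e. $u_i<u_k$ for all $i<k\le j$), then $\pi(i)<\pi(i+1),\ldots,\pi(j)$ (i.e. $\pi(i)<\pi(k)$ for all $i<k\le j$).
   Context: The place-based non-inversion table of $\pi\in S_n$ is the word $u_1\cdots u_n$ with $u_j=1+|\{i<j:\pi(i)<\pi(j)\}|$. -}

module Defs where

open import Data.Nat using (ℕ; suc)
open import Data.Fin using (Fin; _<_; _<?_)
open import Data.Fin.Permutation using (Permutation′; _⟨$⟩ʳ_)
open import Data.List using (List; filter; length)
open import Data.List.Base using (allFin)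
open import Relation.Nullary using (Dec; yes; no)
open import Relation.Nullary.Decidable using (_×-dec_)
open import Data.Product using (_×_)

-- Place-based non-inversion table: u π j = 1 + |{ i < j : π(i) < π(j) }|
-- (positions and values are 0-indexed Fin n; the ordering is the same)
nonInvTable : ∀ {n} → Permutation′ n → Fin n → ℕ
nonInvTable {n} π j =
  suc (length (filter (λ i → (i <? j) ×-dec ((π ⟨$⟩ʳ i) <? (π ⟨$⟩ʳ j))) (allFin n)))

-- Both directions compare two such sets by inclusion and count elements:
--   * a strict inclusion of decidable predicates gives a strict inequality of the number of
--     list elements satisfying them (count-mono, count-strict);
--   * if i < j and π i < π j then NonInv π i ⊊ NonInv π j (i itself is the witness), whence
--     u π i < u π j (rise-increases-table);
--   * if i < k, π k < π i and π i < π m for every m strictly between i and k, then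
--     NonInv π k ⊆ NonInv π i, whence u π k ≤ u π i (first-descent-table).
-- The converse of the theorem follows by well-founded induction on k: the first position
-- k ∈ (i, j] with π k < π i would be a first descent, contradicting u π i < u π k.
module Submission where

open import Defs
open import Data.Nat using (ℕ; s≤s) renaming (_<_ to _<ℕ_; _≤_ to _≤ℕ_)
import Data.Nat.Properties as ℕ
open import Data.Fin using (Fin; _<_; _≤_; _<?_)
open import Data.Fin.Properties using (<-cmp; <-trans; <-irrefl; <-asym)
open import Data.Fin.Induction using (<-wellFounded)
open import Data.Fin.Permutation using (Permutation′; _⟨$⟩ʳ_; _⟨$⟩ˡ_; inverseˡ)
open import Data.List using (_∷_; filter; length; allFin)
open import Data.List.Relation.Unary.Any using (here; there)
open import Data.List.Membership.Propositional using (_∈_)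
open import Data.List.Membership.Propositional.Properties using (∈-allFin)
open import Data.List.Relation.Binary.Sublist.Propositional using (⊆-refl)
open import Data.List.Relation.Binary.Sublist.Propositional.Properties using (filter⁺; length-mono-≤)
open import Data.Product using (_×_; _,_)
open import Data.Empty using (⊥-elim)
open import Induction.WellFounded using (WfRec; module All)
open import Level using (Level)
open import Relation.Binary using (tri<; tri≈; tri>)
open import Relation.Binary.PropositionalEquality using (_≡_; refl; sym; trans; cong)
open import Relation.Nullary using (¬_; yes; no)
open import Relation.Nullary.Decidable using (_×-dec_)
open import Relation.Unary using (Pred; Decidable; _⊆_)

module _ {a p q : Level} {A : Set a} {P : Pred A p} {Q : Pred A q}
         (P? : Decidable P) (Q? : Decidable Q) (P⊆Q : P ⊆ Q) where

  count-mono : ∀ xs → length (filter P? xs) ≤ℕ length (filter Q? xs)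
  count-mono xs = length-mono-≤ (filter⁺ P? Q? (λ { refl → P⊆Q }) (⊆-refl {x = xs}))

  count-strict : ∀ {y} xs → y ∈ xs → Q y → ¬ P y
               → length (filter P? xs) <ℕ length (filter Q? xs)
  count-strict (x ∷ xs) (here refl) qx ¬px with P? x | Q? x
  ... | yes px | _      = ⊥-elim (¬px px)
  ... | no _   | yes _  = s≤s (count-mono xs)
  ... | no _   | no ¬qx = ⊥-elim (¬qx qx)
  count-strict (x ∷ xs) (there y∈xs) qy ¬py with P? x | Q? x
  ... | yes px | yes _  = s≤s (count-strict xs y∈xs qy ¬py)
  ... | yes px | no ¬qx = ⊥-elim (¬qx (P⊆Q px))
  ... | no _   | yes _  = ℕ.m≤n⇒m≤1+n (count-strict xs y∈xs qy ¬py)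
  ... | no _   | no _   = count-strict xs y∈xs qy ¬py

module _ {n : ℕ} (π : Permutation′ n) where

  NonInv : Fin n → Pred (Fin n) _
  NonInv j i = (i < j) × (π ⟨$⟩ʳ i < π ⟨$⟩ʳ j)

  nonInv? : ∀ j → Decidable (NonInv j)
  nonInv? j i = (i <? j) ×-dec (π ⟨$⟩ʳ i <? π ⟨$⟩ʳ j)

  permutation-injective : ∀ {i j} → π ⟨$⟩ʳ i ≡ π ⟨$⟩ʳ j → i ≡ j
  permutation-injective e = trans (sym (inverseˡ π)) (trans (cong (π ⟨$⟩ˡ_) e) (inverseˡ π))

  -- A non-inversion pair (i, j) strictly enlarges the counted set: NonInv i ⊊ NonInv j,
  -- with i itself in the difference.
  rise-increases-table : ∀ i j → i < j → π ⟨$⟩ʳ i < π ⟨$⟩ʳ j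
                       → nonInvTable π i <ℕ nonInvTable π j
  rise-increases-table i j i<j πi<πj =
    s≤s (count-strict (nonInv? i) (nonInv? j) NonInv-i⊆NonInv-j
             (allFin n) (∈-allFin i) (i<j , πi<πj) (λ (i<i , _) → <-irrefl refl i<i))
    where
    NonInv-i⊆NonInv-j : NonInv i ⊆ NonInv j
    NonInv-i⊆NonInv-j (m<i , πm<πi) = <-trans m<i i<j , <-trans πm<πi πi<πj

  -- At the first descent k below the value π i after position i, every position counted
  -- at k is already counted at i: it cannot be i, nor lie strictly between i and k.
  first-descent-table : ∀ i k → i < k → π ⟨$⟩ʳ k < π ⟨$⟩ʳ i
                      → (∀ m → i < m → m < k → π ⟨$⟩ʳ i < π ⟨$⟩ʳ m)
                      → nonInvTable π k ≤ℕ nonInvTable π i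
  first-descent-table i k i<k πk<πi rises-between =
    s≤s (count-mono (nonInv? k) (nonInv? i) NonInv-k⊆NonInv-i (allFin n))
    where
    NonInv-k⊆NonInv-i : NonInv k ⊆ NonInv i
    NonInv-k⊆NonInv-i {m} (m<k , πm<πk) with <-cmp m i
    ... | tri< m<i _ _ = m<i , <-trans πm<πk πk<πi
    ... | tri≈ _ refl _ = ⊥-elim (<-asym πm<πk πk<πi)
    ... | tri> _ _ i<m = ⊥-elim (<-asym (<-trans πm<πk πk<πi) (rises-between m i<m m<k))

  -- Converse direction: if the table rises from i to every k ∈ (i, j], so does π.
  -- By strong induction on k, π rises from i to every position before k, so a descent at k
  -- would be a first descent and contradict u i < u k.
  table-rises⇒rises : ∀ (i j : Fin n)
                    → (∀ (k : Fin n) → i < k → k ≤ j → nonInvTable π i <ℕ nonInvTable π k)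
                    → ∀ (k : Fin n) → i < k → k ≤ j → π ⟨$⟩ʳ i < π ⟨$⟩ʳ k
  table-rises⇒rises i j table-rises = All.wfRec <-wellFounded _ RisesAt step
    where
    RisesAt : Pred (Fin n) _
    RisesAt k = i < k → k ≤ j → π ⟨$⟩ʳ i < π ⟨$⟩ʳ k

    step : ∀ k → WfRec _<_ RisesAt k → RisesAt k
    step k rises-before i<k k≤j with <-cmp (π ⟨$⟩ʳ i) (π ⟨$⟩ʳ k)
    ... | tri< πi<πk _ _ = πi<πk
    ... | tri≈ _ πi≡πk _ = ⊥-elim (<-irrefl (permutation-injective πi≡πk) i<k)
    ... | tri> _ _ πk<πi = ⊥-elim (ℕ.<⇒≱ (table-rises k i<k k≤j)
          (first-descent-table i k i<k πk<πi
            (λ m i<m m<k → rises-before m<k i<m (ℕ.<⇒≤ (ℕ.<-≤-trans m<k k≤j)))))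

lemma6p4 : ∀ (n : ℕ) (π : Permutation′ n)
    → (∀ (i j : Fin n) → i < j → (π ⟨$⟩ʳ i) < (π ⟨$⟩ʳ j) → nonInvTable π i <ℕ nonInvTable π j)
    × (∀ (i j : Fin n) → i < j
    → (∀ (k : Fin n) → i < k → k ≤ j → nonInvTable π i <ℕ nonInvTable π k)
    → ∀ (k : Fin n) → i < k → k ≤ j → (π ⟨$⟩ʳ i) < (π ⟨$⟩ʳ k))
lemma6p4 n π = rise-increases-table π , λ i j _ → table-rises⇒rises π i j
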